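{- There is an algorithm which, given two subshifts of finite type (each given by a finite alphabet and a finite forbidden language), decides whether they are similar, i.e. whether they are equal up to a bijective renaming of their letters.
   Context: The shift $\sigma$ on $\mathcal{A}^{\mathbb{Z}}$ is $\sigma(u)_n=u_{n+1}$. A subshift is a closed, shift-invariant subset of $\mathcal{A}^{\mathbb{Z}}$; it is of finite type (SFT) if it equals the set of bi-infinite words having no subword in some finite set $F$ of finite words. A projection is a map between alphabets extended letter by letter to words; $X\succcurlyeq Y$ means $\varphi(X)=Y$ for some projection $\varphi$, and $X,Y$ are similar if $X\succcurlyeq Y$ and $Y\succcurlyeq X$. -}

module Defs where

open import Data.Nat using (ℕ)
open import Data.Fin using (Fin; toℕ)
open import Data.Integer using (ℤ; +_; _+_)
open import Data.List using (List; length; lookup)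
open import Data.List.Relation.Unary.Any using (Any)
open import Data.Product using (Σ; ∃; _×_)
open import Relation.Nullary using (¬_)
open import Relation.Binary.PropositionalEquality using (_≡_)

BiWord : ℕ → Set
BiWord k = ℤ → Fin k

Word : ℕ → Set
Word k = List (Fin k)

Subset : ℕ → Set₁
Subset k = BiWord k → Set

Occurs : ∀ {k} → Word k → BiWord k → Set
Occurs w u = ∃ λ (n : ℤ) → (i : Fin (length w)) → u (n + + toℕ i) ≡ lookup w i

SFT : ∀ {k} → List (Word k) → Subset k
SFT F u = ¬ Any (λ w → Occurs w u) F

project : ∀ {k l} → (Fin k → Fin l) → BiWord k → BiWord l
project φ u n = φ (u n)

ImageEq : ∀ {k l} → (Fin k → Fin l) → Subset k → Subset l → Set
ImageEq φ X Y =
  ((u : BiWord _) → X u → Y (project φ u)) ×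
  ((v : BiWord _) → Y v → ∃ λ u → X u × ((n : ℤ) → project φ u n ≡ v n))

_≽_ : ∀ {k l} → Subset k → Subset l → Set
_≽_ {k} {l} X Y = ∃ λ (φ : Fin k → Fin l) → ImageEq φ X Y

Similar : ∀ {k l} → Subset k → Subset l → Set
Similar X Y = (X ≽ Y) × (Y ≽ X)

-- Mutual projections φ(X) = Y and ψ(Y) = X make g = φ ∘ ψ a surjection of the finite
-- set of letters used in Y onto itself, so some power g^(e+1) fixes all of them, and
-- χ = ψ ∘ g^e maps Y into X with φ ∘ χ the identity on the letters of Y. Hence X and Y
-- are similar iff there are letter maps φ, χ and ψ, ω forming such "splittings" in
-- both directions. A splitting is a finite combination of questions "does the SFT
-- have a point showing a given pattern", and these are decidable: points are the
-- bi-infinite walks in the de Bruijn graph of allowed blocks, and a vertex lies on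
-- such a walk iff it reaches a cycle both forwards and backwards, along paths whose
-- lengths the pigeonhole principle bounds by the number of vertices.

module Submission where

open import Defs
open import Data.Nat using (ℕ)
open import Data.List using (List)
open import Relation.Nullary using (Dec)

open import Data.Nat using (zero; suc; _+_; _∸_; _^_; _≤_; _<_)
import Data.Nat.Properties as ℕ
open import Data.Nat.GeneralisedArithmetic using (fold; fold-+)
open import Data.Nat.ListAction using (sum)
open import Data.Integer as ℤ using (ℤ; +_; -[1+_]; _-_; 1ℤ) renaming (suc to sucℤ)
import Data.Integer.Properties as ℤ
open import Data.Integer.Tactic.RingSolver using (solve-∀)
open import Data.Fin as Fin using (Fin; toℕ; inject₁; inject≤; finToFun; funToFin)
import Data.Fin.Properties as Fin
open import Data.Fin.Induction using (<-weakInduction)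
open import Data.List using (_∷_; length; lookup; map)
open import Data.List.Membership.Propositional using (_∈_; find; lose)
open import Data.List.Membership.Propositional.Properties using (∈-map⁺)
open import Data.List.Relation.Unary.Any as Any using (Any; here; there)
open import Data.Product using (Σ; ∃; ∃₂; _×_; _,_; proj₁; proj₂)
open import Function using (_∘_; flip)
open import Relation.Nullary using (yes; no; ¬_)
open import Relation.Nullary.Decidable using (map′; _×-dec_; _→-dec_; ¬?)
open import Relation.Unary using (Decidable)
open import Relation.Binary.PropositionalEquality

i+[1+m]≡[1+i]+m : ∀ t m → t ℤ.+ + suc m ≡ sucℤ t ℤ.+ + m
i+[1+m]≡[1+i]+m t m = lemma t (+ m)
  where
  lemma : ∀ t n → t ℤ.+ (1ℤ ℤ.+ n) ≡ (1ℤ ℤ.+ t) ℤ.+ n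
  lemma = solve-∀

1+[i+m]≡i+[1+m] : ∀ t m → sucℤ (t ℤ.+ + m) ≡ t ℤ.+ + suc m
1+[i+m]≡i+[1+m] t m = lemma t (+ m)
  where
  lemma : ∀ t n → 1ℤ ℤ.+ (t ℤ.+ n) ≡ t ℤ.+ (1ℤ ℤ.+ n)
  lemma = solve-∀

1+[i-[1+m]]≡i-m : ∀ t m → sucℤ (t - + suc m) ≡ t - + m
1+[i-[1+m]]≡i-m t m = lemma t (+ m)
  where
  lemma : ∀ t n → 1ℤ ℤ.+ (t - (1ℤ ℤ.+ n)) ≡ t - n
  lemma = solve-∀

∈⇒≤sum : ∀ {m ns} → m ∈ ns → m ≤ sum ns
∈⇒≤sum (here refl)               = ℕ.m≤m+n _ _
∈⇒≤sum {ns = n ∷ _} (there m∈ns) = ℕ.≤-trans (∈⇒≤sum m∈ns) (ℕ.m≤n+m _ n)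

∃-fun? : ∀ {m n} {P : (Fin m → Fin n) → Set} →
         (∀ {f g} → f ≗ g → P f → P g) → Decidable P → Dec (∃ P)
∃-fun? resp P? = map′ (λ (c , p) → finToFun c , p)
                      (λ (f , p) → funToFin f , resp (sym ∘ Fin.finToFun-funToFin f) p)
                      (Fin.any? (P? ∘ finToFun))

funToFin-injective : ∀ {m n} {f g : Fin m → Fin n} → funToFin f ≡ funToFin g → f ≗ g
funToFin-injective {f = f} {g} eq x = begin
  f x                     ≡⟨ Fin.finToFun-funToFin f x ⟨
  finToFun (funToFin f) x ≡⟨ cong (λ c → finToFun c x) eq ⟩
  finToFun (funToFin g) x ≡⟨ Fin.finToFun-funToFin g x ⟩
  g x                     ∎
  where open ≡-Reasoning

iterate-eventually-periodic : ∀ {l} (g : Fin l → Fin l) →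
  ∃₂ λ i e → ∀ b → fold (fold b g i) g (suc e) ≡ fold b g i
iterate-eventually-periodic {l} g
  with i , j , i<j , same ← Fin.pigeonhole (ℕ.n<1+n (l ^ l)) (λ i → funToFin (λ b → fold b g (toℕ i)))
  = toℕ i , e , λ b → begin
      fold (fold b g (toℕ i)) g (suc e) ≡⟨ fold-+ b g (suc e) ⟨
      fold b g (suc e + toℕ i)          ≡⟨ cong (fold b g) 1+e+i≡j ⟩
      fold b g (toℕ j)                  ≡⟨ funToFin-injective same b ⟨
      fold b g (toℕ i)                  ∎
  where
  open ≡-Reasoning
  e : ℕ
  e = toℕ j ∸ suc (toℕ i)
  1+e+i≡j : suc e + toℕ i ≡ toℕ j
  1+e+i≡j = trans (cong suc (ℕ.+-comm e (toℕ i))) (ℕ.m+[n∸m]≡n i<j)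

module FiniteWalks {n : ℕ} (E : Fin n → Fin n → Set) where

  Path : ℕ → Fin n → Fin n → Set
  Path zero    x y = x ≡ y
  Path (suc L) x y = ∃ λ z → E x z × Path L z y

  path? : (∀ x y → Dec (E x y)) → ∀ L x y → Dec (Path L x y)
  path? E? zero    x y = x Fin.≟ y
  path? E? (suc L) x y = Fin.any? λ z → E? x z ×-dec path? E? L z y

  -- x reaches in a ≤ n steps a vertex c on a cycle of length b + 1 ≤ n. The bounds make
  -- this decidable, and by pigeonhole (walk⇒reachesCycle) they lose nothing.
  ReachesCycle : Fin n → Set
  ReachesCycle x =
    ∃ λ c → ∃ λ a → a < suc n × ∃ λ b → b < n × Path a x c × Path (suc b) c c

  reachesCycle? : (∀ x y → Dec (E x y)) → Decidable ReachesCycle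
  reachesCycle? E? x = Fin.any? λ c →
    ℕ.anyUpTo? (λ a → ℕ.anyUpTo? (λ b → path? E? a x c ×-dec path? E? (suc b) c c) n) (suc n)

  reachesCycle-step : ∀ {x} → ReachesCycle x → ∃ λ y → E x y × ReachesCycle y
  reachesCycle-step (c , zero , _ , b , b<n , refl , cycle@(y , xy , yc)) =
    y , xy , c , b , ℕ.m<n⇒m<1+n b<n , b , b<n , yc , cycle
  reachesCycle-step (c , suc a , a<n , b , b<n , (y , xy , yc) , cycle) =
    y , xy , c , a , ℕ.<-trans (ℕ.n<1+n a) a<n , b , b<n , yc , cycle

  Walk : (ℕ → Fin n) → Set
  Walk f = ∀ m → E (f m) (f (suc m))

  walk-from : ∀ {x} → ReachesCycle x → Σ (ℕ → Fin n) λ f → f 0 ≡ x × Walk f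
  walk-from {x} r = proj₁ ∘ states , refl , λ m → proj₁ (proj₂ (reachesCycle-step (proj₂ (states m))))
    where
    next : Σ (Fin n) ReachesCycle → Σ (Fin n) ReachesCycle
    next (_ , r) = proj₁ (reachesCycle-step r) , proj₂ (proj₂ (reachesCycle-step r))
    states : ℕ → Σ (Fin n) ReachesCycle
    states = fold (x , r) next

  walk-segment : ∀ {f} → Walk f → ∀ a L → Path L (f a) (f (a + L))
  walk-segment {f} _    a zero    = cong f (sym (ℕ.+-identityʳ a))
  walk-segment {f} walk a (suc L) =
    f (suc a) , walk a , subst (Path L (f (suc a)) ∘ f) (sym (ℕ.+-suc a L)) (walk-segment walk (suc a) L)

  walk⇒reachesCycle : ∀ {f} → Walk f → ReachesCycle (f 0)
  walk⇒reachesCycle {f} walk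
    with i , j , i<j , fi≡fj ← Fin.pigeonhole (ℕ.n<1+n n) (f ∘ toℕ)
    = f (toℕ i) , toℕ i , Fin.toℕ<n i , b , b<n , walk-segment walk 0 (toℕ i) , cycle
    where
    b : ℕ
    b = toℕ j ∸ suc (toℕ i)
    i+[1+b]≡j : toℕ i + suc b ≡ toℕ j
    i+[1+b]≡j = trans (ℕ.+-suc (toℕ i) b) (ℕ.m+[n∸m]≡n i<j)
    b<n : b < n
    b<n = ℕ.≤-trans (ℕ.m≤n+m (suc b) (toℕ i)) (subst (_≤ n) (sym i+[1+b]≡j) (Fin.toℕ≤pred[n] j))
    cycle : Path (suc b) (f (toℕ i)) (f (toℕ i))
    cycle = subst (Path (suc b) (f (toℕ i))) (trans (cong f i+[1+b]≡j) (sym fi≡fj))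
                  (walk-segment walk (toℕ i) (suc b))

module BiInfiniteWalks {n : ℕ} (E : Fin n → Fin n → Set) (E? : ∀ x y → Dec (E x y)) where

  open FiniteWalks E
  private module Backward = FiniteWalks (flip E)

  BiWalk : (ℤ → Fin n) → Set
  BiWalk w = ∀ t → E (w t) (w (sucℤ t))

  join : (ℕ → Fin n) → (ℕ → Fin n) → ℤ → Fin n
  join f g (+ m)    = f m
  join f g -[1+ m ] = g (suc m)

  join-biWalk : ∀ {f g} → g 0 ≡ f 0 → Walk f → Backward.Walk g → BiWalk (join f g)
  join-biWalk _     forward _        (+ m)        = forward m
  join-biWalk g₀≡f₀ _       backward -[1+ zero ]  = subst (E _) g₀≡f₀ (backward 0)
  join-biWalk _     _       backward -[1+ suc m ] = backward (suc m)

  biWalk? : ∀ {P : Fin n → Set} → Decidable P → Dec (∃ λ w → BiWalk w × ∃ λ t → P (w t))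
  biWalk? {P} P? = map′ sound complete
    (Fin.any? λ x → P? x ×-dec reachesCycle? E? x ×-dec Backward.reachesCycle? (flip E?) x)
    where
    sound : (∃ λ x → P x × ReachesCycle x × Backward.ReachesCycle x) →
            ∃ λ w → BiWalk w × ∃ λ t → P (w t)
    sound (x , px , r , r′) with walk-from r | Backward.walk-from r′
    ... | f , refl , forward | g , g₀≡f₀ , backward =
      join f g , join-biWalk g₀≡f₀ forward backward , + 0 , px

    complete : (∃ λ w → BiWalk w × ∃ λ t → P (w t)) →
               ∃ λ x → P x × ReachesCycle x × Backward.ReachesCycle x
    complete (w , walk , t , p) =
      w t , p , subst ReachesCycle t+0 (walk⇒reachesCycle forward) ,
                subst Backward.ReachesCycle t+0 (Backward.walk⇒reachesCycle backward)
      where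
      t+0 : w (t ℤ.+ + 0) ≡ w t
      t+0 = cong w (ℤ.+-identityʳ t)
      forward : Walk (λ m → w (t ℤ.+ + m))
      forward m = subst (E (w (t ℤ.+ + m)) ∘ w) (1+[i+m]≡i+[1+m] t m) (walk (t ℤ.+ + m))
      backward : Backward.Walk (λ m → w (t - + m))
      backward m = subst (E (w (t - + suc m)) ∘ w) (1+[i-[1+m]]≡i-m t m) (walk (t - + suc m))

window : ∀ {k} d → BiWord k → ℤ → Fin d → Fin k
window d u t i = u (t ℤ.+ + toℕ i)

window-inject≤ : ∀ {k m d} (u : BiWord k) t (h : m ≤ d) i → window d u t (inject≤ i h) ≡ window m u t i
window-inject≤ u t h i = cong (λ j → u (t ℤ.+ + j)) (Fin.toℕ-inject≤ i h)

-- Vertices code the blocks of length suc D. Requiring the source of every edge to be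
-- allowed makes every vertex of a bi-infinite walk allowed.
module DeBruijn {k : ℕ} (F : List (Word k)) (D : ℕ) where

  Vertex : Set
  Vertex = Fin (k ^ suc D)

  block : Vertex → Fin (suc D) → Fin k
  block = finToFun

  _IsPrefixOf_ : Word k → (Fin (suc D) → Fin k) → Set
  f IsPrefixOf β = Σ (length f ≤ suc D) λ h → ∀ i → β (inject≤ i h) ≡ lookup f i

  isPrefixOf? : ∀ f β → Dec (f IsPrefixOf β)
  isPrefixOf? f β with length f ℕ.≤? suc D
  ... | yes h = map′ (h ,_) proj₂ (Fin.all? λ i → β (inject≤ i h) Fin.≟ lookup f i)
  ... | no ¬h = no (¬h ∘ proj₁)

  Allowed : Vertex → Set
  Allowed a = ¬ Any (_IsPrefixOf block a) F

  Edge : Vertex → Vertex → Set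
  Edge a b = Allowed a × ∀ (i : Fin D) → block a (Fin.suc i) ≡ block b (inject₁ i)

  edge? : ∀ a b → Dec (Edge a b)
  edge? a b = ¬? (Any.any? (λ f → isPrefixOf? f (block a)) F)
        ×-dec Fin.all? (λ i → block a (Fin.suc i) Fin.≟ block b (inject₁ i))

  open BiInfiniteWalks Edge edge? public using (BiWalk; biWalk?)

  blocks : BiWord k → ℤ → Vertex
  blocks u t = funToFin (window (suc D) u t)

  block-blocks : ∀ u t i → block (blocks u t) i ≡ window (suc D) u t i
  block-blocks u t = Fin.finToFun-funToFin (window (suc D) u t)

  blocks-window : ∀ {m} u t (h : m ≤ suc D) i → block (blocks u t) (inject≤ i h) ≡ window m u t i
  blocks-window u t h i = trans (block-blocks u t (inject≤ i h)) (window-inject≤ u t h i)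

  blocks-biWalk : ∀ u → SFT F u → BiWalk (blocks u)
  blocks-biWalk u sft t = allowed , overlaps
    where
    open ≡-Reasoning
    allowed : Allowed (blocks u t)
    allowed prefix = sft (Any.map (λ (h , p) → t , λ i → trans (sym (blocks-window u t h i)) (p i)) prefix)
    overlaps : ∀ i → block (blocks u t) (Fin.suc i) ≡ block (blocks u (sucℤ t)) (inject₁ i)
    overlaps i = begin
      block (blocks u t) (Fin.suc i)           ≡⟨ block-blocks u t (Fin.suc i) ⟩
      u (t ℤ.+ + suc (toℕ i))                 ≡⟨ cong u (i+[1+m]≡[1+i]+m t (toℕ i)) ⟩
      u (sucℤ t ℤ.+ + toℕ i)                  ≡⟨ cong (λ m → u (sucℤ t ℤ.+ + m)) (Fin.toℕ-inject₁ i) ⟨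
      u (sucℤ t ℤ.+ + toℕ (inject₁ i))        ≡⟨ block-blocks u (sucℤ t) (inject₁ i) ⟨
      block (blocks u (sucℤ t)) (inject₁ i)   ∎

  letters : (ℤ → Vertex) → BiWord k
  letters w t = block (w t) Fin.zero

  letters-block : ∀ {w} → BiWalk w → ∀ t i → letters w (t ℤ.+ + toℕ i) ≡ block (w t) i
  letters-block {w} walk t i = <-weakInduction P base step i t
    where
    open ≡-Reasoning
    P : Fin (suc D) → Set
    P i = ∀ t → letters w (t ℤ.+ + toℕ i) ≡ block (w t) i
    base : P Fin.zero
    base t = cong (letters w) (ℤ.+-identityʳ t)
    step : ∀ i → P (inject₁ i) → P (Fin.suc i)
    step i ih t = begin
      letters w (t ℤ.+ + suc (toℕ i))          ≡⟨ cong (letters w) (i+[1+m]≡[1+i]+m t (toℕ i)) ⟩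
      letters w (sucℤ t ℤ.+ + toℕ i)           ≡⟨ cong (λ m → letters w (sucℤ t ℤ.+ + m)) (Fin.toℕ-inject₁ i) ⟨
      letters w (sucℤ t ℤ.+ + toℕ (inject₁ i)) ≡⟨ ih (sucℤ t) ⟩
      block (w (sucℤ t)) (inject₁ i)           ≡⟨ proj₂ (walk t) i ⟨
      block (w t) (Fin.suc i)                  ∎

  letters-window : ∀ {w m} → BiWalk w → ∀ t (h : m ≤ suc D) i →
                   window m (letters w) t i ≡ block (w t) (inject≤ i h)
  letters-window {w} walk t h i = trans (sym (window-inject≤ (letters w) t h i)) (letters-block walk t (inject≤ i h))

  letters-SFT : (∀ {f} → f ∈ F → length f ≤ suc D) → ∀ {w} → BiWalk w → SFT F (letters w)
  letters-SFT short walk occurrence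
    with f , f∈F , t , occ ← find occurrence
    = proj₁ (walk t) (lose f∈F (short f∈F , λ i → trans (sym (letters-window walk t (short f∈F) i)) (occ i)))

Admits : ∀ {k} → List (Word k) → (d : ℕ) → ((Fin d → Fin k) → Set) → Set
Admits F d W = ∃ λ u → SFT F u × ∃ λ t → W (window d u t)

admits? : ∀ {k} (F : List (Word k)) d {W : (Fin d → Fin k) → Set} →
          (∀ {v v′} → v ≗ v′ → W v → W v′) → Decidable W → Dec (Admits F d W)
admits? {k} F d {W} W-resp W? = map′ sound complete (biWalk? (W? ∘ prefix))
  where
  D : ℕ
  D = d + sum (map length F)
  open DeBruijn F D
  d≤1+D : d ≤ suc D
  d≤1+D = ℕ.m≤n⇒m≤1+n (ℕ.m≤m+n d _)
  short : ∀ {f} → f ∈ F → length f ≤ suc D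
  short f∈F = ℕ.m≤n⇒m≤1+n (ℕ.≤-trans (∈⇒≤sum (∈-map⁺ length f∈F)) (ℕ.m≤n+m _ d))
  prefix : Vertex → Fin d → Fin k
  prefix a i = block a (inject≤ i d≤1+D)
  sound : (∃ λ w → BiWalk w × ∃ λ t → W (prefix (w t))) → Admits F d W
  sound (w , walk , t , Wt) =
    letters w , letters-SFT short walk , t , W-resp (sym ∘ letters-window walk t d≤1+D) Wt
  complete : Admits F d W → ∃ λ w → BiWalk w × ∃ λ t → W (prefix (w t))
  complete (u , sft , t , Wt) =
    blocks u , blocks-biWalk u sft , t , W-resp (sym ∘ blocks-window u t d≤1+D) Wt

Maps : ∀ {k l} → (Fin k → Fin l) → Subset k → Subset l → Set
Maps φ X Y = ∀ u → X u → Y (project φ u)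

Used : ∀ {l} → Subset l → Fin l → Set
Used Y b = ∃ λ v → Y v × ∃ λ t → v t ≡ b

Splitting : ∀ {k l} → Subset k → Subset l → (Fin k → Fin l) → (Fin l → Fin k) → Set
Splitting X Y φ χ = Maps φ X Y × Maps χ Y X × (∀ b → Used Y b → φ (χ b) ≡ b)

splitting⇒imageEq : ∀ {k l} {X : Subset k} {Y : Subset l} {φ χ} → Splitting X Y φ χ → ImageEq φ X Y
splitting⇒imageEq {χ = χ} (φXY , χYX , section) =
  φXY , λ v Yv → project χ v , χYX v Yv , λ t → section (v t) (v , Yv , t , refl)

module _ {k l} {X : Subset k} {Y : Subset l} (φ : Fin k → Fin l) (ψ : Fin l → Fin k)
         (φXY : ImageEq φ X Y) (ψYX : ImageEq ψ Y X) where

  private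
    g : Fin l → Fin l
    g = φ ∘ ψ

    maps-iterate : ∀ m → Maps (λ b → fold b g m) Y Y
    maps-iterate zero    v Yv = Yv
    maps-iterate (suc m) v Yv = proj₁ φXY _ (proj₁ ψYX _ (maps-iterate m v Yv))

    used-preimage : ∀ {b} → Used Y b → ∃ λ c → Used Y c × g c ≡ b
    used-preimage (v , Yv , t , refl)
      with u , Xu , φu≗v ← proj₂ φXY v Yv
      with v′ , Yv′ , ψv′≗u ← proj₂ ψYX u Xu
      = v′ t , (v′ , Yv′ , t , refl) , trans (cong φ (ψv′≗u t)) (φu≗v t)

    used-iterate-preimage : ∀ m {b} → Used Y b → ∃ λ c → Used Y c × fold c g m ≡ b
    used-iterate-preimage zero    used = _ , used , refl
    used-iterate-preimage (suc m) used
      with c , used-c , refl ← used-preimage used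
      with c′ , used-c′ , refl ← used-iterate-preimage m used-c
      = c′ , used-c′ , refl

  imageEq⇒splitting : ∃ (Splitting X Y φ)
  imageEq⇒splitting
    with i , e , periodic ← iterate-eventually-periodic g
    = ψ ∘ (λ b → fold b g e) , proj₁ φXY , (λ v Yv → proj₁ ψYX _ (maps-iterate e v Yv)) , section
    where
    section : ∀ b → Used Y b → g (fold b g e) ≡ b
    section b used with c , _ , refl ← used-iterate-preimage i used = periodic c

similar⇒splittings : ∀ {k l} {X : Subset k} {Y : Subset l} →
                     Similar X Y → ∃₂ (Splitting X Y) × ∃₂ (Splitting Y X)
similar⇒splittings ((φ , φXY) , (ψ , ψYX)) =
  (φ , imageEq⇒splitting φ ψ φXY ψYX) , (ψ , imageEq⇒splitting ψ φ ψYX φXY)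

splittings⇒similar : ∀ {k l} {X : Subset k} {Y : Subset l} →
                     ∃₂ (Splitting X Y) × ∃₂ (Splitting Y X) → Similar X Y
splittings⇒similar ((φ , χ , s) , (ψ , ω , s′)) =
  (φ , splitting⇒imageEq {φ = φ} {χ} s) , (ψ , splitting⇒imageEq {φ = ψ} {ω} s′)

SFT-resp : ∀ {k} (F : List (Word k)) {u u′} → u ≗ u′ → SFT F u → SFT F u′
SFT-resp F u≗u′ sft occurrence = sft (Any.map (λ (t , occ) → t , λ i → trans (u≗u′ _) (occ i)) occurrence)

maps? : ∀ {k l} (F : List (Word k)) (G : List (Word l)) φ → Dec (Maps φ (SFT F) (SFT G))
maps? {k} F G φ =
  map′ sound complete (¬? (Any.any? (λ g → admits? F (length g) (projectsTo-resp {g}) (projectsTo? g)) G))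
  where
  ProjectsTo : ∀ g → (Fin (length g) → Fin k) → Set
  ProjectsTo g v = ∀ i → φ (v i) ≡ lookup g i
  projectsTo? : ∀ g → Decidable (ProjectsTo g)
  projectsTo? g v = Fin.all? λ i → φ (v i) Fin.≟ lookup g i
  projectsTo-resp : ∀ {g v v′} → v ≗ v′ → ProjectsTo g v → ProjectsTo g v′
  projectsTo-resp v≗v′ p i = trans (cong φ (sym (v≗v′ i))) (p i)
  sound : ¬ Any (λ g → Admits F (length g) (ProjectsTo g)) G → Maps φ (SFT F) (SFT G)
  sound ¬admits u sft occurrence = ¬admits (Any.map (λ (t , occ) → u , sft , t , occ) occurrence)
  complete : Maps φ (SFT F) (SFT G) → ¬ Any (λ g → Admits F (length g) (ProjectsTo g)) G
  complete maps admits with g , g∈G , u , sft , t , occ ← find admits = maps u sft (lose g∈G (t , occ))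

used? : ∀ {l} (G : List (Word l)) b → Dec (Used (SFT G) b)
used? G b =
  map′ sound complete (admits? G 1 (λ v≗v′ → trans (sym (v≗v′ Fin.zero))) (λ v → v Fin.zero Fin.≟ b))
  where
  sound : Admits G 1 (λ v → v Fin.zero ≡ b) → Used (SFT G) b
  sound (v , sft , t , vt≡b) = v , sft , t , trans (cong v (sym (ℤ.+-identityʳ t))) vt≡b
  complete : Used (SFT G) b → Admits G 1 (λ v → v Fin.zero ≡ b)
  complete (v , sft , t , vt≡b) = v , sft , t , trans (cong v (ℤ.+-identityʳ t)) vt≡b

splitting? : ∀ {k l} (F : List (Word k)) (G : List (Word l)) φ χ → Dec (Splitting (SFT F) (SFT G) φ χ)
splitting? F G φ χ =
  maps? F G φ ×-dec maps? G F χ ×-dec Fin.all? (λ b → used? G b →-dec (φ (χ b) Fin.≟ b))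

splitting-resp : ∀ {k l} (F : List (Word k)) (G : List (Word l)) {φ φ′ χ χ′} → φ ≗ φ′ → χ ≗ χ′ →
                 Splitting (SFT F) (SFT G) φ χ → Splitting (SFT F) (SFT G) φ′ χ′
splitting-resp F G {φ} φ≗φ′ χ≗χ′ (φFG , χGF , section) =
    (λ u sft → SFT-resp G (φ≗φ′ ∘ u) (φFG u sft))
  , (λ v sft → SFT-resp F (χ≗χ′ ∘ v) (χGF v sft))
  , λ b used → trans (sym (φ≗φ′ _)) (trans (cong φ (sym (χ≗χ′ b))) (section b used))

splittings? : ∀ {k l} (F : List (Word k)) (G : List (Word l)) → Dec (∃₂ (Splitting (SFT F) (SFT G)))
splittings? F G =
  ∃-fun? (λ φ≗φ′ (χ , s) → χ , splitting-resp F G {χ = χ} {χ} φ≗φ′ (λ _ → refl) s) λ φ →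
  ∃-fun? (splitting-resp F G {φ} {φ} (λ _ → refl)) (splitting? F G φ)

proposition5 : (k l : ℕ) (F : List (Word k)) (G : List (Word l)) →
    Dec (Similar (SFT F) (SFT G))
proposition5 k l F G = map′ splittings⇒similar similar⇒splittings (splittings? F G ×-dec splittings? G F)
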